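{- Let $G=(V,E)$ be a finite, undirected, unweighted, simple, connected graph with $N=|V|$ nodes and $M=|E|$ edges, and let $d_1\ge d_2\ge\dots\ge d_N$ be its degree sequence listed in non-increasing order. Let $n_1\in\{0,1,\dots,N\}$, and let each node $i$ carry a binary characteristic $c_i\in\{0,1\}$ such that exactly $n_1$ nodes have $c_i=1$. Let $m_{11}$ denote the number of edges both of whose endpoints have characteristic $1$. Then $$m_{11}\le UBm_{11}:=\min\Bigg( M,\ \binom{n_1}{2},\ \bigg\lceil \sum_{i=1}^{n_1}\frac{\min(d_i,\,n_1-1)}{2}\bigg\rceil\Bigg).$$
   Context: The degree $d_i$ of a node is the number of edges incident to it. The sum $\sum_{i=1}^{n_1}$ runs over the $n_1$ largest degrees (the "head" of length $n_1$ of the non-increasingly ordered degree sequence); an empty sum is $0$. -}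

module Defs where

open import Data.Nat using (ℕ; zero; suc; _+_; _∸_; _≤_; _<_; _≥_; ⌈_/2⌉) renaming (_⊓_ to min)
open import Data.Bool using (Bool; true; false; if_then_else_; _∧_)
open import Data.Fin using (Fin; toℕ; _<?_)
open import Data.List using (List; []; _∷_; map; allFin)
open import Data.Nat.ListAction using (sum)
open import Data.Product using (Σ; _×_; _,_)
open import Relation.Nullary using (does)
open import Relation.Binary.PropositionalEquality using (_≡_)
open import Data.Fin.Permutation using (Permutation′; _⟨$⟩ʳ_)

count : ∀ {n} → (Fin n → Bool) → ℕ
count {n} p = sum (map (λ i → if p i then 1 else 0) (allFin n))

record SimpleGraph (N : ℕ) : Set where
  field
    adj    : Fin N → Fin N → Bool
    sym    : ∀ i j → adj i j ≡ adj j i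
    irrefl : ∀ i → adj i i ≡ false
open SimpleGraph public

data Reach {N : ℕ} (G : SimpleGraph N) : Fin N → Fin N → Set where
  here : ∀ i → Reach G i i
  step : ∀ i j k → adj G i j ≡ true → Reach G j k → Reach G i k

Connected : ∀ {N} → SimpleGraph N → Set
Connected {N} G = (1 ≤ N) × (∀ i j → Reach G i j)

degree : ∀ {N} → SimpleGraph N → Fin N → ℕ
degree G i = count (λ j → adj G i j)

countPairs : ∀ {N} → (Fin N → Fin N → Bool) → ℕ
countPairs {N} r = sum (map (λ i → count (λ j → does (i <? j) ∧ r i j)) (allFin N))

numEdges : ∀ {N} → SimpleGraph N → ℕ
numEdges G = countPairs (adj G)

m11 : ∀ {N} → SimpleGraph N → (Fin N → Bool) → ℕ
m11 G c = countPairs (λ i j → adj G i j ∧ c i ∧ c j)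

-- σ lists the vertices in non-increasing order of degree:
-- d_k := degree (σ k) satisfies d_0 ≥ d_1 ≥ ... ≥ d_{N-1}.
DegreeSorting : ∀ {N} → SimpleGraph N → Permutation′ N → Set
DegreeSorting {N} G σ = ∀ (k l : Fin N) → toℕ k ≤ toℕ l → degree G (σ ⟨$⟩ʳ k) ≥ degree G (σ ⟨$⟩ʳ l)

headSum : ∀ {N} → SimpleGraph N → Permutation′ N → ℕ → ℕ
headSum {N} G σ n1 =
  sum (map (λ k → if does (toℕ k Data.Nat.<? n1) then min (degree G (σ ⟨$⟩ʳ k)) (n1 ∸ 1) else 0) (allFin N))
  where import Data.Nat

-- ⌈ Σ min(d_i, n1-1)/2 ⌉ = ⌈ S / 2 ⌉ with S the integer sum above.

-- Count each edge inside the 1-class from both endpoints: 2 m₁₁ is the sum over 1-nodes i of the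
-- number of 1-neighbours of i, and that number is at most min (dᵢ, n₁ − 1). A sum of n₁ such terms
-- with dᵢ ranging over the degrees of the 1-nodes is largest when the n₁ largest degrees are taken,
-- giving 2 m₁₁ ≤ Σ_{i ≤ n₁} min (dᵢ, n₁ − 1). The bounds M and C(n₁, 2) hold because m₁₁ counts a
-- subset of the edges and of the pairs of 1-nodes respectively.
module Submission where

open import Defs
open import Data.Nat using (ℕ; _≤_; ⌈_/2⌉) renaming (_⊓_ to min)
open import Data.Nat.Combinatorics using (_C_)
open import Data.Bool using (Bool; true)
open import Data.Fin using (Fin)
open import Data.Fin.Permutation using (Permutation′)
open import Relation.Binary.PropositionalEquality using (_≡_)

open import Data.Nat using (zero; suc; _+_; _∸_; _<_; z≤n; s≤s; _<?_)
open import Data.Nat.Properties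
open import Data.Nat.Combinatorics using (nC1≡n; nCk+nC[k+1]≡[n+1]C[k+1])
open import Data.Bool using (false; if_then_else_; _∧_; f≤t; b≤b) renaming (_≤_ to _≤ᵇ_)
open import Data.Bool.Properties using (∧-zeroʳ; ∧-comm)
open import Data.Fin using (toℕ) renaming (zero to fzero; suc to fsuc; _<?_ to _<ᶠ?_)
open import Data.Fin.Permutation using (_⟨$⟩ʳ_)
open import Data.List using (map; allFin; tabulate)
import Data.Nat.ListAction as List
open import Relation.Nullary using (does)
open import Relation.Binary.PropositionalEquality using (refl; trans; cong; cong₂; module ≡-Reasoning)
  renaming (sym to ≡-sym)
open import Algebra.Properties.CommutativeMonoid.Sum +-0-commutativeMonoid
  using (sum; sum-cong-≗; sum-replicate-zero; ∑-distrib-+; ∑-permute)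
open import Algebra.Properties.CommutativeSemigroup +-commutativeSemigroup using (interchange)

𝟙 : Bool → ℕ
𝟙 b = if b then 1 else 0

𝟙-mono : ∀ {a b} → a ≤ᵇ b → 𝟙 a ≤ 𝟙 b
𝟙-mono f≤t = z≤n
𝟙-mono b≤b = ≤-refl

∧-≤ˡ : ∀ a b → a ∧ b ≤ᵇ a
∧-≤ˡ false b     = b≤b
∧-≤ˡ true  false = f≤t
∧-≤ˡ true  true  = b≤b

∧-≤ʳ : ∀ a b → a ∧ b ≤ᵇ b
∧-≤ʳ false false = b≤b
∧-≤ʳ false true  = f≤t
∧-≤ʳ true  b     = b≤b

∧-monoʳ-≤ : ∀ a {b c} → b ≤ᵇ c → a ∧ b ≤ᵇ a ∧ c
∧-monoʳ-≤ false b≤c = b≤b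
∧-monoʳ-≤ true  b≤c = b≤c

sum-mono-≤ : ∀ {n} {f g : Fin n → ℕ} → (∀ i → f i ≤ g i) → sum f ≤ sum g
sum-mono-≤ {zero}  f≤g = z≤n
sum-mono-≤ {suc n} f≤g = +-mono-≤ (f≤g fzero) (sum-mono-≤ (λ i → f≤g (fsuc i)))

sum-map-tabulate : ∀ {n} {A : Set} (f : A → ℕ) (g : Fin n → A) →
  List.sum (map f (tabulate g)) ≡ sum (λ i → f (g i))
sum-map-tabulate {zero}  f g = refl
sum-map-tabulate {suc n} f g = cong (f (g fzero) +_) (sum-map-tabulate f (λ i → g (fsuc i)))

sum-map-allFin : ∀ {n} (f : Fin n → ℕ) → List.sum (map f (allFin n)) ≡ sum f
sum-map-allFin f = sum-map-tabulate f (λ i → i)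

count≡sum : ∀ {n} (p : Fin n → Bool) → count p ≡ sum (λ i → 𝟙 (p i))
count≡sum p = sum-map-allFin (λ i → 𝟙 (p i))

count-suc : ∀ {n} (p : Fin (suc n) → Bool) → count p ≡ 𝟙 (p fzero) + count (λ i → p (fsuc i))
count-suc p = trans (count≡sum p) (cong (𝟙 (p fzero) +_) (≡-sym (count≡sum (λ i → p (fsuc i)))))

count-false : ∀ {n} {p : Fin n → Bool} → (∀ i → p i ≡ false) → count p ≡ 0
count-false {n} {p} p≡false =
  trans (count≡sum p) (trans (sum-cong-≗ (λ i → cong 𝟙 (p≡false i))) (sum-replicate-zero n))

count-mono : ∀ {n} {p q : Fin n → Bool} → (∀ i → p i ≤ᵇ q i) → count p ≤ count q
count-mono {p = p} {q} p≤q = begin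
  count p               ≡⟨ count≡sum p ⟩
  sum (λ i → 𝟙 (p i))   ≤⟨ sum-mono-≤ (λ i → 𝟙-mono (p≤q i)) ⟩
  sum (λ i → 𝟙 (q i))   ≡⟨ count≡sum q ⟨
  count q               ∎
  where open ≤-Reasoning

count-mono-< : ∀ {n} {p q : Fin n → Bool} → (∀ i → p i ≤ᵇ q i) →
  ∀ k → p k ≡ false → q k ≡ true → count p < count q
count-mono-< {suc n} {p} {q} p≤q fzero pk≡false qk≡true
  rewrite count-suc p | count-suc q | pk≡false | qk≡true =
  s≤s (count-mono (λ i → p≤q (fsuc i)))
count-mono-< {suc n} {p} {q} p≤q (fsuc k) pk≡false qk≡true
  rewrite count-suc p | count-suc q =
  +-mono-≤-< (𝟙-mono (p≤q fzero)) (count-mono-< (λ i → p≤q (fsuc i)) k pk≡false qk≡true)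

count-permute : ∀ {n} (p : Fin n → Bool) (σ : Permutation′ n) → count (λ k → p (σ ⟨$⟩ʳ k)) ≡ count p
count-permute p σ = begin
  count (λ k → p (σ ⟨$⟩ʳ k))        ≡⟨ count≡sum (λ k → p (σ ⟨$⟩ʳ k)) ⟩
  sum (λ k → 𝟙 (p (σ ⟨$⟩ʳ k)))      ≡⟨ ∑-permute (λ i → 𝟙 (p i)) σ ⟨
  sum (λ i → 𝟙 (p i))               ≡⟨ count≡sum p ⟨
  count p                           ∎
  where open ≡-Reasoning

-- Vertex 0 is paired with every later vertex, and the guard i < j is unchanged by shifting both.
countPairs-suc : ∀ {n} (r : Fin (suc n) → Fin (suc n) → Bool) →
  countPairs r ≡ count (λ j → r fzero (fsuc j)) + countPairs (λ i j → r (fsuc i) (fsuc j))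
countPairs-suc {n} r = begin
  countPairs r                                      ≡⟨ sum-map-allFin row ⟩
  row fzero + sum (λ i → row (fsuc i))
    ≡⟨ cong₂ _+_ (count-suc (row′ fzero)) (sum-cong-≗ (λ i → count-suc (row′ (fsuc i)))) ⟩
  count (λ j → r fzero (fsuc j)) + sum shiftedRow
    ≡⟨ cong (count (λ j → r fzero (fsuc j)) +_) (sum-map-allFin shiftedRow) ⟨
  count (λ j → r fzero (fsuc j)) + countPairs (λ i j → r (fsuc i) (fsuc j)) ∎
  where
  open ≡-Reasoning
  row′ : Fin (suc n) → Fin (suc n) → Bool
  row′ i j = does (i <ᶠ? j) ∧ r i j
  row : Fin (suc n) → ℕ
  row i = count (row′ i)
  shiftedRow : Fin n → ℕ
  shiftedRow i = count (λ j → does (i <ᶠ? j) ∧ r (fsuc i) (fsuc j))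

countPairs-mono : ∀ {n} {r s : Fin n → Fin n → Bool} → (∀ i j → r i j ≤ᵇ s i j) → countPairs r ≤ countPairs s
countPairs-mono {n} {r} {s} r≤s = begin
  countPairs r    ≡⟨ sum-map-allFin {n} _ ⟩
  sum (λ i → count (λ j → does (i <ᶠ? j) ∧ r i j))
    ≤⟨ sum-mono-≤ (λ i → count-mono (λ j → ∧-monoʳ-≤ (does (i <ᶠ? j)) (r≤s i j))) ⟩
  sum (λ i → count (λ j → does (i <ᶠ? j) ∧ s i j))
    ≡⟨ sum-map-allFin {n} _ ⟨
  countPairs s    ∎
  where open ≤-Reasoning

countPairs-∧ : ∀ {n} (c : Fin n → Bool) → countPairs (λ i j → c i ∧ c j) ≡ count c C 2
countPairs-∧ {zero}  c = refl
countPairs-∧ {suc n} c rewrite countPairs-suc (λ i j → c i ∧ c j) | count-suc c with c fzero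
... | true  = begin
  k + countPairs (λ i j → c (fsuc i) ∧ c (fsuc j))  ≡⟨ cong₂ _+_ (≡-sym (nC1≡n k)) (countPairs-∧ (λ i → c (fsuc i))) ⟩
  k C 1 + k C 2                                     ≡⟨ nCk+nC[k+1]≡[n+1]C[k+1] k 1 ⟩
  suc k C 2                                         ∎
  where
  open ≡-Reasoning
  k = count (λ i → c (fsuc i))
... | false = trans (cong (_+ countPairs (λ i j → c (fsuc i) ∧ c (fsuc j))) (count-false {n} {λ _ → false} (λ _ → refl)))
                    (countPairs-∧ (λ i → c (fsuc i)))

-- Each pair {i, j} with r i j is counted once in the row of i and once in the row of j.
countPairs-handshake : ∀ {n} (r : Fin n → Fin n → Bool) → (∀ i j → r i j ≡ r j i) →
  countPairs r + countPairs r ≤ sum (λ i → count (r i))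
countPairs-handshake {zero}  r r-sym = z≤n
countPairs-handshake {suc n} r r-sym = begin
  countPairs r + countPairs r        ≡⟨ cong₂ _+_ (countPairs-suc r) (countPairs-suc r) ⟩
  (a + P) + (a + P)                  ≡⟨ interchange a P a P ⟩
  (a + a) + (P + P)                  ≤⟨ +-monoʳ-≤ (a + a) (countPairs-handshake r′ (λ i j → r-sym (fsuc i) (fsuc j))) ⟩
  (a + a) + Q                        ≤⟨ +-monoˡ-≤ Q (+-monoˡ-≤ a (m≤n+m a (𝟙 (r fzero fzero)))) ⟩
  (𝟙 (r fzero fzero) + a) + a + Q    ≡⟨ +-assoc (𝟙 (r fzero fzero) + a) a Q ⟩
  (𝟙 (r fzero fzero) + a) + (a + Q)  ≡⟨ cong₂ (λ x y → x + (y + Q)) (count-suc (r fzero)) column ⟨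
  count (r fzero) + (sum (λ i → 𝟙 (r (fsuc i) fzero)) + Q)
    ≡⟨ cong (count (r fzero) +_) (∑-distrib-+ (λ i → 𝟙 (r (fsuc i) fzero)) (λ i → count (r′ i))) ⟨
  count (r fzero) + sum (λ i → 𝟙 (r (fsuc i) fzero) + count (r′ i))
    ≡⟨ cong (count (r fzero) +_) (sum-cong-≗ (λ i → count-suc (r (fsuc i)))) ⟨
  sum (λ i → count (r i))       ∎
  where
  open ≤-Reasoning
  r′ : Fin n → Fin n → Bool
  r′ i j = r (fsuc i) (fsuc j)
  a P Q : ℕ
  a = count (λ j → r fzero (fsuc j))
  P = countPairs r′
  Q = sum (λ i → count (r′ i))
  column : sum (λ i → 𝟙 (r (fsuc i) fzero)) ≡ a
  column = trans (sum-cong-≗ (λ i → cong 𝟙 (r-sym (fsuc i) fzero))) (≡-sym (count≡sum (λ j → r fzero (fsuc j))))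

Antitone : ∀ {n} → (Fin n → ℕ) → Set
Antitone a = ∀ k l → toℕ k ≤ toℕ l → a l ≤ a k

antitone-tail : ∀ {n} {a : Fin (suc n) → ℕ} → Antitone a → Antitone (λ k → a (fsuc k))
antitone-tail a↓ k l k≤l = a↓ (fsuc k) (fsuc l) (s≤s k≤l)

sumWhere : ∀ {n} → (Fin n → Bool) → (Fin n → ℕ) → ℕ
sumWhere b a = sum (λ k → if b k then a k else 0)

sumHead : ∀ {n} → ℕ → (Fin n → ℕ) → ℕ
sumHead m = sumWhere (λ k → does (toℕ k <? m))

sumHead-tail-≤ : ∀ {n} {a : Fin (suc n) → ℕ} → Antitone a → ∀ m → sumHead m (λ k → a (fsuc k)) ≤ sumHead m a
sumHead-tail-≤ {n}     a↓ zero    = ≤-trans (≤-reflexive (sum-replicate-zero n)) z≤n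
sumHead-tail-≤ {zero}  a↓ (suc m) = z≤n
sumHead-tail-≤ {suc n} a↓ (suc m) =
  +-mono-≤ (a↓ fzero (fsuc fzero) z≤n) (sumHead-tail-≤ (antitone-tail a↓) m)

sumWhere≤sumHead : ∀ {n} {a : Fin n → ℕ} → Antitone a → ∀ b → sumWhere b a ≤ sumHead (count b) a
sumWhere≤sumHead {zero}      a↓ b = z≤n
sumWhere≤sumHead {suc n} {a} a↓ b rewrite count-suc b with b fzero
... | true  = +-monoʳ-≤ (a fzero) (sumWhere≤sumHead (antitone-tail a↓) (λ k → b (fsuc k)))
... | false = ≤-trans (sumWhere≤sumHead (antitone-tail a↓) (λ k → b (fsuc k)))
                      (sumHead-tail-≤ a↓ (count (λ k → b (fsuc k))))

module _ {N} (G : SimpleGraph N) (c : Fin N → Bool) where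

  degreeIn : Fin N → ℕ
  degreeIn i = count (λ j → adj G i j ∧ c j)

  degreeIn≤degree : ∀ i → degreeIn i ≤ degree G i
  degreeIn≤degree i = count-mono (λ j → ∧-≤ˡ (adj G i j) (c j))

  -- i lies in the class but is not its own neighbour.
  degreeIn<count : ∀ i → c i ≡ true → degreeIn i < count c
  degreeIn<count i cᵢ = count-mono-< (λ j → ∧-≤ʳ (adj G i j) (c j)) i (cong (_∧ c i) (irrefl G i)) cᵢ

  m11-row≤ : ∀ i → count (λ j → adj G i j ∧ c i ∧ c j) ≤ (if c i then min (degree G i) (count c ∸ 1) else 0)
  m11-row≤ i with c i in cᵢ
  ... | true  = ⊓-glb (degreeIn≤degree i) (∸-monoˡ-≤ 1 (degreeIn<count i cᵢ))
  ... | false = ≤-reflexive (count-false (λ j → ∧-zeroʳ (adj G i j)))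

  m11-sym : ∀ i j → (adj G i j ∧ c i ∧ c j) ≡ (adj G j i ∧ c j ∧ c i)
  m11-sym i j rewrite SimpleGraph.sym G i j = cong (adj G j i ∧_) (∧-comm (c i) (c j))

  m11-double≤headSum : (σ : Permutation′ N) → DegreeSorting G σ → m11 G c + m11 G c ≤ headSum G σ (count c)
  m11-double≤headSum σ sorted = begin
    m11 G c + m11 G c                                ≤⟨ countPairs-handshake (λ i j → adj G i j ∧ c i ∧ c j) m11-sym ⟩
    sum (λ i → count (λ j → adj G i j ∧ c i ∧ c j))  ≤⟨ sum-mono-≤ m11-row≤ ⟩
    sumWhere c h                                     ≡⟨ ∑-permute (λ i → if c i then h i else 0) σ ⟩
    sumWhere (λ k → c (σ ⟨$⟩ʳ k)) hσ                 ≤⟨ sumWhere≤sumHead hσ-antitone (λ k → c (σ ⟨$⟩ʳ k)) ⟩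
    sumHead (count (λ k → c (σ ⟨$⟩ʳ k))) hσ          ≡⟨ cong (λ m → sumHead m hσ) (count-permute c σ) ⟩
    sumHead (count c) hσ                             ≡⟨ sum-map-allFin {N} _ ⟨
    headSum G σ (count c)                            ∎
    where
    open ≤-Reasoning
    h hσ : Fin N → ℕ
    h i = min (degree G i) (count c ∸ 1)
    hσ k = h (σ ⟨$⟩ʳ k)
    hσ-antitone : Antitone hσ
    hσ-antitone k l k≤l = ⊓-monoˡ-≤ (count c ∸ 1) (sorted k l k≤l)

proposition3p1 : (N : ℕ) (G : SimpleGraph N) → Connected G →
    (σ : Permutation′ N) → DegreeSorting G σ →
    (n1 : ℕ) → n1 ≤ N → (c : Fin N → Bool) → count (λ i → c i) ≡ n1 →
    m11 G c ≤ min (numEdges G) (min (n1 C 2) ⌈ headSum G σ n1 /2⌉)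
proposition3p1 N G _ σ sorted n1 _ c refl = ⊓-glb m11≤numEdges (⊓-glb m11≤n1C2 m11≤⌈headSum/2⌉)
  where
  m11≤numEdges : m11 G c ≤ numEdges G
  m11≤numEdges = countPairs-mono (λ i j → ∧-≤ˡ (adj G i j) (c i ∧ c j))

  m11≤n1C2 : m11 G c ≤ count c C 2
  m11≤n1C2 = ≤-trans (countPairs-mono (λ i j → ∧-≤ʳ (adj G i j) (c i ∧ c j))) (≤-reflexive (countPairs-∧ c))

  m11≤⌈headSum/2⌉ : m11 G c ≤ ⌈ headSum G σ (count c) /2⌉
  m11≤⌈headSum/2⌉ = ≤-trans (≤-reflexive (n≡⌈n+n/2⌉ (m11 G c))) (⌈n/2⌉-mono (m11-double≤headSum G c σ sorted))
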